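{- Let $G$ be a graph that does not contain the cycle $C_4$ or the cycle $C_6$ as a subgraph. For every metric-locating-dominating set $S\subseteq V(G)$, the set $S\cup\pi(S)$ is a locating-dominating set of $G$. Consequently, $\gamma_L(G)\leq \gamma_M(G)^2$.
   Context: All graphs are finite, simple, undirected and connected, with at least $2$ vertices; $d(u,v)$ is the length of a shortest $u$-$v$ path and $N(x)$ is the set of neighbors of $x$. A set $S\subseteq V(G)$ is a resolving set if for every two distinct vertices $x,y$ there is $u\in S$ with $d(u,x)\neq d(u,y)$. $S$ is a dominating set if every vertex not in $S$ has a neighbor in $S$. $S$ is a metric-locating-dominating set if it is both resolving and dominating; $\gamma_M(G)$ is the minimum size of such a set. $S$ is a locating-dominating set if it is dominating and $N(x)\cap S\neq N(y)\cap S$ for every two distinct $x,y\in V(G)\setminus S$; $\gamma_L(G)$ is the minimum size of such a set. For $S\subseteq V(G)$ in a graph with no $C_4$ or $C_6$ subgraph, for each pair $u,v\in S$ define $\pi(u,v)=\{u',v'\}$ if there is a path $(u,u',v',v)$ in $G$ (such a path is then unique), and $\pi(u,v)=\emptyset$ otherwise; set $\pi(S)=\bigcup_{u,v\in S}\pi(u,v)$. -}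

module Defs where

open import Data.Nat using (ℕ; zero; suc; _≤_; _<_)
open import Data.Fin using (Fin)
open import Data.Fin.Subset using (Subset; _∈_; _∉_; ∣_∣)
open import Data.Bool using (Bool; true; false; T)
open import Data.Product using (Σ; ∃; _×_; _,_)
open import Data.Sum using (_⊎_)
open import Data.List using (List; []; _∷_)
open import Data.List.Relation.Unary.Unique.Propositional using (Unique)
open import Relation.Binary.PropositionalEquality using (_≡_; _≢_)
open import Relation.Nullary using (¬_)
open import Function.Bundles using (_⇔_)

data Walk {n : ℕ} (adj : Fin n → Fin n → Bool) : Fin n → Fin n → ℕ → Set where
  here : ∀ {u} → Walk adj u u zero
  step : ∀ {u w v k} → T (adj u w) → Walk adj w v k → Walk adj u v (suc k)

record Graph : Set where
  field
    n         : ℕ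
    adj       : Fin n → Fin n → Bool
    symmetric : ∀ u v → adj u v ≡ adj v u
    loopless  : ∀ u → adj u u ≡ false
    atLeast2  : 2 ≤ n
    connected : ∀ u v → ∃ λ k → Walk adj u v k

module _ (G : Graph) where
  open Graph G

  V : Set
  V = Fin n

  Adj : V → V → Set
  Adj u v = T (adj u v)

  Dist : V → V → ℕ → Set
  Dist u v k = Walk adj u v k × (∀ j → j < k → ¬ Walk adj u v j)

  HasC4 : Set
  HasC4 = Σ V λ a → Σ V λ b → Σ V λ c → Σ V λ d →
            Unique (a ∷ b ∷ c ∷ d ∷ []) ×
            Adj a b × Adj b c × Adj c d × Adj d a

  HasC6 : Set
  HasC6 = Σ V λ a → Σ V λ b → Σ V λ c → Σ V λ d → Σ V λ e → Σ V λ f →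
            Unique (a ∷ b ∷ c ∷ d ∷ e ∷ f ∷ []) ×
            Adj a b × Adj b c × Adj c d × Adj d e × Adj e f × Adj f a

  Resolving : Subset n → Set
  Resolving S = ∀ x y → x ≢ y →
    Σ V λ u → u ∈ S × Σ ℕ λ k → Σ ℕ λ l → Dist u x k × Dist u y l × k ≢ l

  Dominating : Subset n → Set
  Dominating S = ∀ x → x ∉ S → Σ V λ u → u ∈ S × Adj x u

  MetricLocatingDominating : Subset n → Set
  MetricLocatingDominating S = Resolving S × Dominating S

  Locating : Subset n → Set
  Locating S = ∀ x y → x ∉ S → y ∉ S → x ≢ y →
    ¬ (∀ u → u ∈ S → (Adj x u ⇔ Adj y u))

  LocatingDominating : Subset n → Set
  LocatingDominating S = Dominating S × Locating S

  IsGammaM : ℕ → Set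
  IsGammaM k = Σ (Subset n) (λ S → MetricLocatingDominating S × ∣ S ∣ ≡ k)
             × (∀ S → MetricLocatingDominating S → k ≤ ∣ S ∣)

  IsGammaL : ℕ → Set
  IsGammaL k = Σ (Subset n) (λ S → LocatingDominating S × ∣ S ∣ ≡ k)
             × (∀ S → LocatingDominating S → k ≤ ∣ S ∣)

  InPi : Subset n → V → Set
  InPi S w = Σ V λ u → Σ V λ v → Σ V λ u' → Σ V λ v' →
    u ∈ S × v ∈ S × Unique (u ∷ u' ∷ v' ∷ v ∷ []) ×
    Adj u u' × Adj u' v' × Adj v' v × (w ≡ u' ⊎ w ≡ v')

  IsSUnionPi : Subset n → Subset n → Set
  IsSUnionPi S T = ∀ w → w ∈ T ⇔ (w ∈ S ⊎ InPi S w)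

-- If x, y ∉ T have the same neighbours in T ⊇ S, their common S-neighbour a is
-- unique because G has no C4. As T contains the S-private ends w of the paths
-- (s, w, z, a) between vertices of S, any walk from u ∈ S to x can be rerouted,
-- through a T-neighbour of x or through a, into a walk to y that is no longer.
-- By symmetry d(u, x) = d(u, y) for every u ∈ S, so S does not resolve x and y.
-- Without C4 and C6 each pair (s, a) of S has at most one such private end,
-- which gives a set T of at most |S|² vertices.
module Submission where

open import Defs
open import Data.Nat using (ℕ; _≤_; _^_)
open import Data.Fin.Subset using (Subset)
open import Data.Product using (_×_)
open import Relation.Nullary using (¬_)

open import Data.Nat using (suc; _+_; _*_; z≤n; s≤s)
open import Data.Nat.Properties using (≤-refl; ≤-trans; ≤-reflexive; ≤-antisym; n≤1+n; m≤n⇒m≤1+n; +-suc; +-mono-≤; ≮⇒≥)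
open import Data.Fin using (Fin; zero; suc; _≟_)
open import Data.Fin.Subset using (_∈_; _∉_; _⊆_; _∪_; ⊥; ⁅_⁆; ∣_∣; inside; outside)
open import Data.Fin.Subset.Properties using (_∈?_; x∈⁅x⁆; ∣⁅x⁆∣≡1; ∣⊥∣≡0; p⊆p∪q; q⊆p∪q)
open import Data.Fin.Properties using (any?; all?)
import Data.Bool as Bool
open import Data.Bool.Properties using (T?)
open import Data.Vec using ([]; _∷_; here; there)
open import Data.List using ([]; _∷_)
open import Data.List.Relation.Unary.All using ([]; _∷_)
open import Data.List.Relation.Unary.AllPairs using ([]; _∷_)
open import Data.List.Relation.Unary.Unique.Propositional using (Unique)
import Data.List.Relation.Unary.Unique.DecPropositional as UniqueDec
open import Data.Product using (∃; _,_; proj₁; proj₂)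
open import Data.Sum using (inj₁; inj₂)
open import Data.Empty using (⊥-elim)
open import Function using (_∘_)
open import Function.Bundles using (Equivalence)
open import Relation.Binary.PropositionalEquality using (_≡_; _≢_; ≢-sym; refl; sym; subst)
open import Relation.Nullary using (Dec; yes; no; ¬?)
open import Relation.Nullary.Decidable using (_×-dec_; _→-dec_)

∈∉⇒≢ : ∀ {m} {S : Subset m} {u w} → u ∈ S → w ∉ S → u ≢ w
∈∉⇒≢ u∈S w∉S refl = w∉S u∈S

∉∈⇒≢ : ∀ {m} {S : Subset m} {w u} → w ∉ S → u ∈ S → w ≢ u
∉∈⇒≢ w∉S u∈S = ≢-sym (∈∉⇒≢ u∈S w∉S)

unique4 : ∀ {A : Set} {a b c d : A} → a ≢ b → a ≢ c → a ≢ d → b ≢ c → b ≢ d → c ≢ d →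
          Unique (a ∷ b ∷ c ∷ d ∷ [])
unique4 ab ac ad bc bd cd = (ab ∷ ac ∷ ad ∷ []) ∷ (bc ∷ bd ∷ []) ∷ (cd ∷ []) ∷ [] ∷ []

∣p∪q∣≤∣p∣+∣q∣ : ∀ {m} (p q : Subset m) → ∣ p ∪ q ∣ ≤ ∣ p ∣ + ∣ q ∣
∣p∪q∣≤∣p∣+∣q∣ []            []            = z≤n
∣p∪q∣≤∣p∣+∣q∣ (outside ∷ p) (outside ∷ q) = ∣p∪q∣≤∣p∣+∣q∣ p q
∣p∪q∣≤∣p∣+∣q∣ (outside ∷ p) (inside  ∷ q) =
  ≤-trans (s≤s (∣p∪q∣≤∣p∣+∣q∣ p q)) (≤-reflexive (sym (+-suc ∣ p ∣ ∣ q ∣)))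
∣p∪q∣≤∣p∣+∣q∣ (inside  ∷ p) (outside ∷ q) = s≤s (∣p∪q∣≤∣p∣+∣q∣ p q)
∣p∪q∣≤∣p∣+∣q∣ (inside  ∷ p) (inside  ∷ q) =
  s≤s (≤-trans (m≤n⇒m≤1+n (∣p∪q∣≤∣p∣+∣q∣ p q)) (≤-reflexive (sym (+-suc ∣ p ∣ ∣ q ∣))))

⋃[_]_ : ∀ {n m} → Subset n → (Fin n → Subset m) → Subset m
⋃[ []          ] F = ⊥
⋃[ outside ∷ S ] F = ⋃[ S ] (F ∘ suc)
⋃[ inside  ∷ S ] F = F zero ∪ ⋃[ S ] (F ∘ suc)

F⊆⋃[S]F : ∀ {n m} {S : Subset n} {F : Fin n → Subset m} {s} → s ∈ S → F s ⊆ ⋃[ S ] F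
F⊆⋃[S]F {S = inside ∷ S} {F} here         = p⊆p∪q (⋃[ S ] (F ∘ suc))
F⊆⋃[S]F {S = outside ∷ S}     (there s∈S) = F⊆⋃[S]F s∈S
F⊆⋃[S]F {S = inside ∷ S} {F}  (there s∈S) = q⊆p∪q (F zero) _ ∘ F⊆⋃[S]F s∈S

∣⋃[S]F∣≤∣S∣*c : ∀ {n m} (S : Subset n) (F : Fin n → Subset m) {c} →
               (∀ s → ∣ F s ∣ ≤ c) → ∣ ⋃[ S ] F ∣ ≤ ∣ S ∣ * c
∣⋃[S]F∣≤∣S∣*c {m = m} []            F bound = ≤-reflexive (∣⊥∣≡0 m)
∣⋃[S]F∣≤∣S∣*c         (outside ∷ S) F bound = ∣⋃[S]F∣≤∣S∣*c S (F ∘ suc) (bound ∘ suc)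
∣⋃[S]F∣≤∣S∣*c         (inside  ∷ S) F bound =
  ≤-trans (∣p∪q∣≤∣p∣+∣q∣ (F zero) (⋃[ S ] (F ∘ suc)))
          (+-mono-≤ (bound zero) (∣⋃[S]F∣≤∣S∣*c S (F ∘ suc) (bound ∘ suc)))

module _ {n} {P : Fin n → Set} where

  witnessOr : Fin n → Dec (∃ P) → Subset n
  witnessOr _ (yes (w , _)) = ⁅ w ⁆
  witnessOr d (no _)        = ⁅ d ⁆

  ∣witnessOr∣≡1 : ∀ d P? → ∣ witnessOr d P? ∣ ≡ 1
  ∣witnessOr∣≡1 _ (yes (w , _)) = ∣⁅x⁆∣≡1 w
  ∣witnessOr∣≡1 d (no _)        = ∣⁅x⁆∣≡1 d

  witness∈witnessOr : (∀ {w w'} → P w → P w' → w ≡ w') →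
                      ∀ d P? {w} → P w → w ∈ witnessOr d P?
  witness∈witnessOr unique _ (yes (w , Pw)) Pw' = subst (_∈ ⁅ w ⁆) (unique Pw Pw') (x∈⁅x⁆ w)
  witness∈witnessOr unique _ (no ¬P)        Pw' = ⊥-elim (¬P (_ , Pw'))

  default∈witnessOr : ∀ d P? → ¬ ∃ P → d ∈ witnessOr d P?
  default∈witnessOr _ (yes p) ¬P = ⊥-elim (¬P p)
  default∈witnessOr d (no _)  _  = x∈⁅x⁆ d

module _ (G : Graph) where
  open Graph G using (adj; symmetric; loopless)

  private
    _~_ : V G → V G → Set
    u ~ v = Adj G u v

    Vertices : Set
    Vertices = Subset (Graph.n G)

  ~-sym : ∀ {u v} → u ~ v → v ~ u
  ~-sym {u} {v} = subst Bool.T (symmetric u v)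

  ~⇒≢ : ∀ {u v} → u ~ v → u ≢ v
  ~⇒≢ {u} u~u refl = subst Bool.T (loopless u) u~u

  _~?_ : ∀ u v → Dec (u ~ v)
  u ~? v = T? (adj u v)

  snoc : ∀ {u w v k} → Walk adj u w k → w ~ v → Walk adj u v (suc k)
  snoc here         w~v = step w~v here
  snoc (step u~x r) w~v = step u~x (snoc r w~v)

  reverse : ∀ {u v k} → Walk adj u v k → Walk adj v u k
  reverse here         = here
  reverse (step u~w r) = snoc (reverse r) (~-sym u~w)

  Dist⇒≤length : ∀ {u v l j} → Dist G u v l → Walk adj u v j → l ≤ j
  Dist⇒≤length (_ , shortest) r = ≮⇒≥ (λ j<l → shortest _ j<l r)

  common-neighbour-unique : ¬ HasC4 G → ∀ {x y a b} → x ≢ y →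
                            x ~ a → y ~ a → x ~ b → y ~ b → b ≡ a
  common-neighbour-unique noC4 {x} {y} {a} {b} x≢y xa ya xb yb with b ≟ a
  ... | yes b≡a = b≡a
  ... | no  b≢a = ⊥-elim (noC4 (x , a , y , b ,
          unique4 (~⇒≢ xa) x≢y (~⇒≢ xb) (≢-sym (~⇒≢ ya)) (≢-sym b≢a) (~⇒≢ yb) ,
          xa , ~-sym ya , yb , ~-sym xb))

  Path3 : V G → V G → V G → V G → Set
  Path3 s w z a = Unique (s ∷ w ∷ z ∷ a ∷ []) × s ~ w × w ~ z × z ~ a

  path3 : ∀ {s w z a} → s ~ w → w ~ z → z ~ a → s ≢ z → s ≢ a → w ≢ a → Path3 s w z a
  path3 sw wz za s≢z s≢a w≢a = unique4 (~⇒≢ sw) s≢z s≢a (~⇒≢ wz) w≢a (~⇒≢ za) , sw , wz , za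

  OnlyNeighbourIn : Vertices → V G → V G → Set
  OnlyNeighbourIn S w s = ∀ t → t ∈ S → w ~ t → t ≡ s

  -- The only vertices of π(S) that the locating argument needs.
  PrivateEnd : Vertices → V G → V G → V G → Set
  PrivateEnd S s a w = w ∉ S × OnlyNeighbourIn S w s × ∃ λ z → Path3 s w z a

  PrivateEndsIn : Vertices → Vertices → Set
  PrivateEndsIn S T = ∀ {s a w} → s ∈ S → a ∈ S → PrivateEnd S s a w → w ∈ T

  module Twins (noC4 : ¬ HasC4 G) {S T : Vertices} (dom : Dominating G S) (S⊆T : S ⊆ T)
               (closed : PrivateEndsIn S T) {x y : V G} (x≢y : x ≢ y) (x∉T : x ∉ T)
               (x→y : ∀ {p} → p ∈ T → x ~ p → y ~ p) where

    x∉S : x ∉ S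
    x∉S = x∉T ∘ S⊆T

    a : V G
    a = proj₁ (dom x x∉S)

    a∈S : a ∈ S
    a∈S = proj₁ (proj₂ (dom x x∉S))

    xa : x ~ a
    xa = proj₂ (proj₂ (dom x x∉S))

    ya : y ~ a
    ya = x→y (S⊆T a∈S) xa

    onlyX : OnlyNeighbourIn S x a
    onlyX t t∈S xt = common-neighbour-unique noC4 x≢y xa ya xt (x→y (S⊆T t∈S) xt)

    -- A neighbour p ∉ T of x sees S only through a, for otherwise x would be
    -- a private end of a path (a, x, p, t).
    onlyP : ∀ {p} → p ∉ T → x ~ p → OnlyNeighbourIn S p a
    onlyP {p} p∉T xp t t∈S pt with t ≟ a
    ... | yes t≡a = t≡a
    ... | no  t≢a = ⊥-elim (x∉T (closed a∈S t∈S (x∉S , onlyX , p ,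
            path3 (~-sym xa) xp pt (∈∉⇒≢ a∈S (p∉T ∘ S⊆T)) (≢-sym t≢a) (∉∈⇒≢ x∉S t∈S))))

    pa : ∀ {p} → p ∉ T → x ~ p → p ~ a
    pa {p} p∉T xp with dom p (p∉T ∘ S⊆T)
    ... | b , b∈S , pb = subst (p ~_) (onlyP p∉T xp b b∈S pb) pb

    shortcut : ∀ {u k} → u ∈ S → Walk adj x u k → ∃ λ j → j ≤ k × Walk adj y u j
    shortcut u∈S here = ⊥-elim (x∉S u∈S)
    shortcut u∈S (step {w = p} xp r) with p ∈? T
    ... | yes p∈T = _ , ≤-refl , step (x→y p∈T xp) r
    ... | no  p∉T = shortcut₂ r
      where
      p∉S : p ∉ S
      p∉S = p∉T ∘ S⊆T

      shortcut₂ : ∀ {k} → Walk adj p _ k → ∃ λ j → j ≤ suc k × Walk adj y _ j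
      shortcut₂ here = ⊥-elim (p∉S u∈S)
      shortcut₂ (step {w = q} pq r) with q ∈? S
      ... | yes q∈S = _ , n≤1+n _ , step (subst (y ~_) (sym (onlyP p∉T xp q q∈S pq)) ya) r
      ... | no  q∉S with dom q q∉S
      ...   | b , b∈S , qb with b ≟ a
      ...     | yes refl = _ , ≤-refl , step ya (step (~-sym qb) r)
      ...     | no  b≢a  = ⊥-elim (p∉T (closed a∈S b∈S (p∉S , onlyP p∉T xp , q ,
                  path3 (~-sym (pa p∉T xp)) pq qb (∈∉⇒≢ a∈S q∉S) (≢-sym b≢a) (∉∈⇒≢ p∉S b∈S))))

    dist-y≤dist-x : ∀ {u k l} → u ∈ S → Dist G u x k → Dist G u y l → l ≤ k
    dist-y≤dist-x u∈S (ux , _) dy with shortcut u∈S (reverse ux)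
    ... | j , j≤k , yu = ≤-trans (Dist⇒≤length dy (reverse yu)) j≤k

  locatingDominating : ¬ HasC4 G → ∀ {S T} → MetricLocatingDominating G S →
                       S ⊆ T → PrivateEndsIn S T → LocatingDominating G T
  locatingDominating noC4 {S} {T} (resolving , dom) S⊆T closed = dominating , locating
    where
    dominating : Dominating G T
    dominating x x∉T with dom x (x∉T ∘ S⊆T)
    ... | a , a∈S , xa = a , S⊆T a∈S , xa

    locating : Locating G T
    locating x y x∉T y∉T x≢y same with resolving x y x≢y
    ... | u , u∈S , k , l , dx , dy , k≢l = k≢l (≤-antisym
          (Twins.dist-y≤dist-x noC4 dom S⊆T closed (≢-sym x≢y) y∉T
             (λ {p} p∈T → Equivalence.from (same p p∈T)) u∈S dy dx)
          (Twins.dist-y≤dist-x noC4 dom S⊆T closed x≢y x∉T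
             (λ {p} p∈T → Equivalence.to (same p p∈T)) u∈S dx dy))

  privateEnd-unique : ¬ HasC4 G → ¬ HasC6 G → ∀ {S s a w w'} → a ∈ S →
                      PrivateEnd S s a w → PrivateEnd S s a w' → w ≡ w'
  privateEnd-unique noC4 noC6 {S} {s} {a} {w} {w'} a∈S
    (_ , onlyW  , z  , ((s≢w  ∷ s≢z  ∷ s≢a ∷ []) ∷ (w≢z   ∷ w≢a  ∷ []) ∷ (z≢a  ∷ []) ∷ [] ∷ []) , sw  , wz  , za)
    (_ , onlyW' , z' , ((s≢w' ∷ s≢z' ∷ _   ∷ []) ∷ (w'≢z' ∷ w'≢a ∷ []) ∷ (z'≢a ∷ []) ∷ [] ∷ []) , sw' , wz' , z'a)
    with w ≟ w' | w ≟ z' | z ≟ w' | z ≟ z'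
  ... | yes w≡w' | _ | _ | _ = w≡w'
  ... | no _ | yes refl | _ | _ = ⊥-elim (s≢a (sym (onlyW a a∈S z'a)))
  ... | no _ | no _ | yes refl | _ = ⊥-elim (s≢a (sym (onlyW' a a∈S za)))
  ... | no w≢w' | no _ | no z≢w' | yes refl =
        ⊥-elim (noC4 (s , w , z , w' , unique4 s≢w s≢z s≢w' w≢z w≢w' z≢w' , sw , wz , ~-sym wz' , ~-sym sw'))
  ... | no w≢w' | no w≢z' | no z≢w' | no z≢z' =
        ⊥-elim (noC6 (s , w , z , a , z' , w' ,
          ((s≢w ∷ s≢z ∷ s≢a ∷ s≢z' ∷ s≢w' ∷ []) ∷ (w≢z ∷ w≢a ∷ w≢z' ∷ w≢w' ∷ []) ∷
           (z≢a ∷ z≢z' ∷ z≢w' ∷ []) ∷ (≢-sym z'≢a ∷ ≢-sym w'≢a ∷ []) ∷ (≢-sym w'≢z' ∷ []) ∷ [] ∷ []) ,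
          sw , wz , za , ~-sym z'a , ~-sym wz' , ~-sym sw'))

  privateEnd? : ∀ S s a → Dec (∃ (PrivateEnd S s a))
  privateEnd? S s a = any? λ w →
    ¬? (w ∈? S) ×-dec
    all? (λ t → t ∈? S →-dec (w ~? t →-dec t ≟ s)) ×-dec
    any? (λ z → UniqueDec.unique? _≟_ _ ×-dec s ~? w ×-dec w ~? z ×-dec z ~? a)

  no-privateEnd-loop : ∀ {S s} → ¬ ∃ (PrivateEnd S s s)
  no-privateEnd-loop (_ , _ , _ , _ , ((_ ∷ _ ∷ s≢s ∷ []) ∷ _) , _) = s≢s refl

  locatingDominating-≤-square : ¬ HasC4 G → ¬ HasC6 G → ∀ {S} → MetricLocatingDominating G S →
                                ∃ λ T → LocatingDominating G T × ∣ T ∣ ≤ ∣ S ∣ ^ 2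
  locatingDominating-≤-square noC4 noC6 {S} mld = T , locatingDominating noC4 mld S⊆T closed , ∣T∣≤
    where
    -- The pair (s, s) has no private end and contributes s, which puts S inside T.
    end : V G → V G → Vertices
    end s a = witnessOr s (privateEnd? S s a)

    T : Vertices
    T = ⋃[ S ] λ s → ⋃[ S ] λ a → end s a

    S⊆T : S ⊆ T
    S⊆T {s} s∈S = F⊆⋃[S]F s∈S (F⊆⋃[S]F s∈S (default∈witnessOr s (privateEnd? S s s) no-privateEnd-loop))

    closed : PrivateEndsIn S T
    closed {s} {a} s∈S a∈S e = F⊆⋃[S]F s∈S (F⊆⋃[S]F a∈S
      (witness∈witnessOr (privateEnd-unique noC4 noC6 a∈S) s (privateEnd? S s a) e))

    ∣T∣≤ : ∣ T ∣ ≤ ∣ S ∣ * (∣ S ∣ * 1)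
    ∣T∣≤ = ∣⋃[S]F∣≤∣S∣*c S _ λ s → ∣⋃[S]F∣≤∣S∣*c S _ λ a → ≤-reflexive (∣witnessOr∣≡1 s (privateEnd? S s a))

proposition1 : (G : Graph) → ¬ HasC4 G → ¬ HasC6 G →
    ((S T : Subset (Graph.n G)) → MetricLocatingDominating G S →
      IsSUnionPi G S T → LocatingDominating G T)
    × ((kM kL : ℕ) → IsGammaM G kM → IsGammaL G kL → kL ≤ kM ^ 2)
proposition1 G noC4 noC6 = S∪πS-locatingDominating , γL≤γM²
  where
  S∪πS-locatingDominating : (S T : Subset (Graph.n G)) → MetricLocatingDominating G S →
                            IsSUnionPi G S T → LocatingDominating G T
  S∪πS-locatingDominating S T mld T≡S∪πS = locatingDominating G noC4 mld
    (λ {w} w∈S → Equivalence.from (T≡S∪πS w) (inj₁ w∈S))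
    (λ { {s} {a} {w} s∈S a∈S (_ , _ , z , uniq , sw , wz , za) →
         Equivalence.from (T≡S∪πS w) (inj₂ (s , a , w , z , s∈S , a∈S , uniq , sw , wz , za , inj₁ refl)) })

  γL≤γM² : (kM kL : ℕ) → IsGammaM G kM → IsGammaL G kL → kL ≤ kM ^ 2
  γL≤γM² kM kL ((S , mld , ∣S∣≡kM) , _) (_ , minimal) with locatingDominating-≤-square G noC4 noC6 mld
  ... | T , ld , ∣T∣≤∣S∣² = ≤-trans (minimal T ld) (subst (λ k → ∣ T ∣ ≤ k ^ 2) ∣S∣≡kM ∣T∣≤∣S∣²)
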